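{- Let $\eta\in\{0,1\}$ and $\vdash_\eta P$. Then there do not exist processes $P_1,P_2$ and names $\tilde a$ such that $P\equiv(\nu\tilde a)(P_1|P_2)$, $P_1\xrightarrow{\tau}P_1'$ and $P_2\xrightarrow{\tau}P_2'$ for some $P_1',P_2'$, with both of these transitions being interactions.
   Context: Asynchronous $\pi$-calculus: processes $P ::= a\langle\tilde b\rangle \mid\ !a(\tilde b).P \mid P|Q \mid (\nu a)P \mid G$, $G ::= \mathbf 0 \mid a(\tilde b).P \mid \tau.P \mid [a=b]G \mid G+G'$, well-sorted under a fixed sorting; $\equiv$ is standard structural congruence and $\xrightarrow{\mu}$ the standard early LTS of the asynchronous $\pi$-calculus. A reduction $P\xrightarrow{\tau}P'$ is an interaction if its derivation uses the communication rule (synchronisation of an input with an output), as opposed to e.g. firing a $\tau$-prefix. Names are partitioned into output-controlled ($x,y,z$) and input-controlled ($u,v,w$). Judgements $\vdash_\eta P$, $\eta\in\{0,1\}$: $\vdash_1 u(\tilde a).P$ if $\vdash_1P$; $\vdash_0 x(\tilde a).P$, $\vdash_0 !x(\tilde a).P$ if $\vdash_1P$; $\vdash_1x\langle\tilde a\rangle$; $\vdash_0u\langle\tilde a\rangle$; $\vdash_\eta(\nu a)P$ if $\vdash_\eta P$; $\vdash_0\mathbf0$; $\vdash_{\eta_1+\eta_2}P|Q$ if $\vdash_{\eta_1}P$, $\vdash_{\eta_2}Q$, $\eta_1+\eta_2\le1$; $\vdash_\eta G_1+G_2$ if $\vdash_\eta G_1,G_2$; $\vdash_\eta\tau.P$ if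 $\vdash_\eta P$; $\vdash_0[a=b]G$ if $\vdash_0G$. -}

module Defs where

open import Data.Nat using (ℕ; _+_; _≤_)
open import Data.List using (List; []; _∷_; _++_)
open import Data.List.Relation.Unary.All using (All; []; _∷_)
  renaming (map to mapAll)
open import Data.List.Relation.Unary.Any using (here; there)
open import Data.List.Membership.Propositional using (_∈_)
open import Data.Empty using (⊥)
open import Data.Unit using (⊤)
open import Relation.Binary.PropositionalEquality using (_≡_; refl)

data Kind : Set where
  outputControlled inputControlled : Kind

-- A fixed sorting: a set of sorts, the object sort-list of each sort
-- (ob s = sorts of the names carried by a name of sort s), and the
-- partition of names into output-/input-controlled, which is a property
-- of the sort of a name (so it is preserved by well-sorted substitution).
record Sorting : Set₁ where
  field
    Sort : Set
    ob   : Sort → List Sort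
    kind : Sort → Kind

module Calculus (S : Sorting) where
  open Sorting S

  -- Processes of type  Proc Γ  are exactly the well-sorted processes whose
  -- free names are in Γ (alpha-conversion is built in).
  Ctx : Set
  Ctx = List Sort

  infixr 6 _∥_
  infixr 7 _⊕_

  mutual
    data Proc (Γ : Ctx) : Set where
      send : ∀ {s} (a : s ∈ Γ) (c : All (_∈ Γ) (ob s)) → Proc Γ
      repl : ∀ {s} (a : s ∈ Γ) (P : Proc (ob s ++ Γ)) → Proc Γ
      _∥_  : Proc Γ → Proc Γ → Proc Γ
      ν    : (t : Sort) → Proc (t ∷ Γ) → Proc Γ
      grd  : Guard Γ → Proc Γ

    data Guard (Γ : Ctx) : Set where
      𝟎     : Guard Γ
      recv  : ∀ {s} (a : s ∈ Γ) (P : Proc (ob s ++ Γ)) → Guard Γ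
      tau   : Proc Γ → Guard Γ
      [_≐_]_ : ∀ {s t} (a : s ∈ Γ) (b : t ∈ Γ) → Guard Γ → Guard Γ
      _⊕_   : Guard Γ → Guard Γ → Guard Γ

  Ren : Ctx → Ctx → Set
  Ren Γ Δ = ∀ {s} → s ∈ Γ → s ∈ Δ

  extL : ∀ {Γ Δ} (Θ : Ctx) → Ren Γ Δ → Ren (Θ ++ Γ) (Θ ++ Δ)
  extL []      ρ m         = ρ m
  extL (t ∷ Θ) ρ (here p)  = here p
  extL (t ∷ Θ) ρ (there m) = there (extL Θ ρ m)

  mutual
    rename : ∀ {Γ Δ} → Ren Γ Δ → Proc Γ → Proc Δ
    rename ρ (send a c)  = send (ρ a) (mapAll ρ c)
    rename ρ (repl {s} a P) = repl (ρ a) (rename (extL (ob s) ρ) P)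
    rename ρ (P ∥ Q)     = rename ρ P ∥ rename ρ Q
    rename ρ (ν t P)     = ν t (rename (extL (t ∷ []) ρ) P)
    rename ρ (grd G)     = grd (renameG ρ G)

    renameG : ∀ {Γ Δ} → Ren Γ Δ → Guard Γ → Guard Δ
    renameG ρ 𝟎              = 𝟎
    renameG ρ (recv {s} a P) = recv (ρ a) (rename (extL (ob s) ρ) P)
    renameG ρ (tau P)        = tau (rename ρ P)
    renameG ρ ([ a ≐ b ] G)  = [ ρ a ≐ ρ b ] renameG ρ G
    renameG ρ (G ⊕ H)        = renameG ρ G ⊕ renameG ρ H

  wk : ∀ {Γ} (Θ : Ctx) → Ren Γ (Θ ++ Γ)
  wk []      m = m
  wk (t ∷ Θ) m = there (wk Θ m)

  ins : ∀ {Γ t} (Θ : Ctx) → Ren (Θ ++ Γ) (Θ ++ t ∷ Γ)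
  ins []      m         = there m
  ins (u ∷ Θ) (here p)  = here p
  ins (u ∷ Θ) (there m) = there (ins Θ m)

  hole : ∀ {Γ t} (Θ : Ctx) → t ∈ Θ ++ t ∷ Γ
  hole []      = here refl
  hole (u ∷ Θ) = there (hole Θ)

  swap : ∀ {Γ t} (Θ : Ctx) → Ren (Θ ++ t ∷ Γ) (t ∷ Θ ++ Γ)
  swap []      m         = m
  swap (u ∷ Θ) (here p)  = there (here p)
  swap (u ∷ Θ) (there m) with swap Θ m
  ... | here q  = here q
  ... | there k = there (there k)

  inst : ∀ {Γ} {Θ : Ctx} → All (_∈ Γ) Θ → Ren (Θ ++ Γ) Γ
  inst []       m         = m
  inst (x ∷ xs) (here refl) = x
  inst (x ∷ xs) (there m) = inst xs m

  νs : ∀ {Γ} (Θ : Ctx) → Proc (Θ ++ Γ) → Proc Γ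
  νs []      P = P
  νs (t ∷ Θ) P = νs Θ (ν t P)

  data Occurs {Γ : Ctx} {t : Sort} (x : t ∈ Γ) : ∀ {ss : Ctx} → All (_∈ Γ) ss → Set where
    hd : ∀ {ss : Ctx} {ys : All (_∈ Γ) ss} → Occurs x (x ∷ ys)
    tl : ∀ {s : Sort} {ss : Ctx} {y : s ∈ Γ} {ys : All (_∈ Γ) ss} → Occurs x ys → Occurs x (y ∷ ys)

  infix 4 _≃_ _≃ᵍ_
  mutual
    data _≃_ {Γ : Ctx} : Proc Γ → Proc Γ → Set where
      ≃-refl  : ∀ {P} → P ≃ P
      ≃-sym   : ∀ {P Q} → P ≃ Q → Q ≃ P
      ≃-trans : ∀ {P Q R} → P ≃ Q → Q ≃ R → P ≃ R
      ≃-par   : ∀ {P P' Q Q'} → P ≃ P' → Q ≃ Q' → P ∥ Q ≃ P' ∥ Q'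
      ≃-res   : ∀ {t} {P P' : Proc (t ∷ Γ)} → P ≃ P' → ν t P ≃ ν t P'
      ≃-repl  : ∀ {s} {a : s ∈ Γ} {P P'} → P ≃ P' → repl a P ≃ repl a P'
      ≃-grd   : ∀ {G G'} → G ≃ᵍ G' → grd G ≃ grd G'
      par-nil   : ∀ {P} → P ∥ grd 𝟎 ≃ P
      par-comm  : ∀ {P Q} → P ∥ Q ≃ Q ∥ P
      par-assoc : ∀ {P Q R} → (P ∥ Q) ∥ R ≃ P ∥ (Q ∥ R)
      res-nil   : ∀ {t} → ν t (grd 𝟎) ≃ grd 𝟎
      res-swap  : ∀ {t u} {P : Proc (u ∷ t ∷ Γ)} →
                  ν t (ν u P) ≃ ν u (ν t (rename (swap (u ∷ [])) P))
      res-par   : ∀ {t} {P : Proc (t ∷ Γ)} {Q} →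
                  ν t P ∥ Q ≃ ν t (P ∥ rename (wk (t ∷ [])) Q)

    data _≃ᵍ_ {Γ : Ctx} : Guard Γ → Guard Γ → Set where
      ≃ᵍ-refl  : ∀ {G} → G ≃ᵍ G
      ≃ᵍ-sym   : ∀ {G H} → G ≃ᵍ H → H ≃ᵍ G
      ≃ᵍ-trans : ∀ {G H K} → G ≃ᵍ H → H ≃ᵍ K → G ≃ᵍ K
      ≃ᵍ-recv  : ∀ {s} {a : s ∈ Γ} {P P'} → P ≃ P' → recv a P ≃ᵍ recv a P'
      ≃ᵍ-tau   : ∀ {P P'} → P ≃ P' → tau P ≃ᵍ tau P'
      ≃ᵍ-match : ∀ {s t} {a : s ∈ Γ} {b : t ∈ Γ} {G G'} →
                 G ≃ᵍ G' → [ a ≐ b ] G ≃ᵍ [ a ≐ b ] G'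
      ≃ᵍ-sum   : ∀ {G G' H H'} → G ≃ᵍ G' → H ≃ᵍ H' → G ⊕ H ≃ᵍ G' ⊕ H'
      sum-nil   : ∀ {G} → G ⊕ 𝟎 ≃ᵍ G
      sum-comm  : ∀ {G H} → G ⊕ H ≃ᵍ H ⊕ G
      sum-assoc : ∀ {G H K} → (G ⊕ H) ⊕ K ≃ᵍ G ⊕ (H ⊕ K)

  -- Early LTS.  An action from context Γ indexes the context of the
  -- residual: τ, early input a<c~>, and (bound) output (ν Θ) a<c~>
  -- where Θ are the extruded names (Θ = [] : free output).

  data Act (Γ : Ctx) : Ctx → Set where
    τ    : Act Γ Γ
    inA  : ∀ {s} (a : s ∈ Γ) (c : All (_∈ Γ) (ob s)) → Act Γ Γ
    outA : ∀ {s} (Θ : Ctx) (a : s ∈ Γ) (c : All (_∈ Θ ++ Γ) (ob s)) → Act Γ (Θ ++ Γ)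

  actRen : ∀ {Γ Γ'} → Act Γ Γ' → Ren Γ Γ'
  actRen τ            m = m
  actRen (inA a c)    m = m
  actRen (outA Θ a c) m = wk Θ m

  infix 4 _—[_]→_ _—[_]→ᵍ_
  mutual
    data _—[_]→ᵍ_ {Γ : Ctx} : ∀ {Γ'} → Guard Γ → Act Γ Γ' → Proc Γ' → Set where
      g-in    : ∀ {s} {a : s ∈ Γ} {P} (c : All (_∈ Γ) (ob s)) →
                recv a P —[ inA a c ]→ᵍ rename (inst c) P
      g-tau   : ∀ {P} → tau P —[ τ ]→ᵍ P
      g-match : ∀ {s} {a : s ∈ Γ} {G Γ'} {μ : Act Γ Γ'} {P'} →
                G —[ μ ]→ᵍ P' → [ a ≐ a ] G —[ μ ]→ᵍ P'
      g-sumL  : ∀ {G H Γ'} {μ : Act Γ Γ'} {P'} → G —[ μ ]→ᵍ P' → G ⊕ H —[ μ ]→ᵍ P'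
      g-sumR  : ∀ {G H Γ'} {μ : Act Γ Γ'} {P'} → H —[ μ ]→ᵍ P' → G ⊕ H —[ μ ]→ᵍ P'

    data _—[_]→_ {Γ : Ctx} : ∀ {Γ'} → Proc Γ → Act Γ Γ' → Proc Γ' → Set where
      t-out   : ∀ {s} {a : s ∈ Γ} {c} → send a c —[ outA [] a c ]→ grd 𝟎
      t-rep   : ∀ {s} {a : s ∈ Γ} {P} (c : All (_∈ Γ) (ob s)) →
                repl a P —[ inA a c ]→ rename (inst c) P ∥ repl a P
      t-grd   : ∀ {G Γ'} {μ : Act Γ Γ'} {P'} → G —[ μ ]→ᵍ P' → grd G —[ μ ]→ P'
      t-parL  : ∀ {Γ'} {P P' Q} {μ : Act Γ Γ'} →
                P —[ μ ]→ P' → P ∥ Q —[ μ ]→ P' ∥ rename (actRen μ) Q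
      t-parR  : ∀ {Γ'} {P Q Q'} {μ : Act Γ Γ'} →
                Q —[ μ ]→ Q' → P ∥ Q —[ μ ]→ rename (actRen μ) P ∥ Q'
      -- communication (with close when Θ ≠ []): the output P and the input Q
      t-commL : ∀ {s} {a : s ∈ Γ} {Θ c P P' Q Q'} →
                P —[ outA Θ a c ]→ P' →
                rename (wk Θ) Q —[ inA (wk Θ a) c ]→ Q' →
                P ∥ Q —[ τ ]→ νs Θ (P' ∥ Q')
      t-commR : ∀ {s} {a : s ∈ Γ} {Θ c P P' Q Q'} →
                rename (wk Θ) P —[ inA (wk Θ a) c ]→ P' →
                Q —[ outA Θ a c ]→ Q' →
                P ∥ Q —[ τ ]→ νs Θ (P' ∥ Q')
      t-resτ   : ∀ {t} {P P' : Proc (t ∷ Γ)} →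
                 P —[ τ ]→ P' → ν t P —[ τ ]→ ν t P'
      t-resIn  : ∀ {t s} {a : s ∈ Γ} {c} {P P' : Proc (t ∷ Γ)} →
                 P —[ inA (there a) (mapAll there c) ]→ P' →
                 ν t P —[ inA a c ]→ ν t P'
      t-resOut : ∀ {t s} {a : s ∈ Γ} {Θ c} {P : Proc (t ∷ Γ)} {P'} →
                 P —[ outA Θ (there a) (mapAll (ins Θ) c) ]→ P' →
                 ν t P —[ outA Θ a c ]→ ν t (rename (swap Θ) P')
      t-open   : ∀ {t s} {a : s ∈ Γ} {Θ} {c : All (_∈ Θ ++ t ∷ Γ) (ob s)}
                   {P : Proc (t ∷ Γ)} {P'} →
                 P —[ outA Θ (there a) c ]→ P' →
                 Occurs (hole Θ) c →
                 ν t P —[ outA (t ∷ Θ) a (mapAll (swap Θ) c) ]→ rename (swap Θ) P'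

  Interaction : ∀ {Γ Γ'} {P : Proc Γ} {μ : Act Γ Γ'} {P'} → P —[ μ ]→ P' → Set
  Interaction t-out          = ⊥
  Interaction (t-rep c)      = ⊥
  Interaction (t-grd d)      = ⊥
  Interaction (t-parL d)     = Interaction d
  Interaction (t-parR d)     = Interaction d
  Interaction (t-commL d e)  = ⊤
  Interaction (t-commR d e)  = ⊤
  Interaction (t-resτ d)     = Interaction d
  Interaction (t-resIn d)    = Interaction d
  Interaction (t-resOut d)   = Interaction d
  Interaction (t-open d o)   = Interaction d

  infix 4 ⊢_∶_ ⊢ᵍ_∶_
  mutual
    data ⊢_∶_ {Γ : Ctx} : ℕ → Proc Γ → Set where
      ty-repX : ∀ {s} {a : s ∈ Γ} {P} → kind s ≡ outputControlled →
                ⊢ 1 ∶ P → ⊢ 0 ∶ repl a P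
      ty-outX : ∀ {s} {a : s ∈ Γ} {c} → kind s ≡ outputControlled → ⊢ 1 ∶ send a c
      ty-outU : ∀ {s} {a : s ∈ Γ} {c} → kind s ≡ inputControlled → ⊢ 0 ∶ send a c
      ty-res  : ∀ {η t} {P : Proc (t ∷ Γ)} → ⊢ η ∶ P → ⊢ η ∶ ν t P
      ty-par  : ∀ {η₁ η₂ P Q} → ⊢ η₁ ∶ P → ⊢ η₂ ∶ Q → η₁ + η₂ ≤ 1 →
                ⊢ η₁ + η₂ ∶ P ∥ Q
      ty-grd  : ∀ {η G} → ⊢ᵍ η ∶ G → ⊢ η ∶ grd G

    data ⊢ᵍ_∶_ {Γ : Ctx} : ℕ → Guard Γ → Set where
      ty-nil   : ⊢ᵍ 0 ∶ 𝟎
      ty-inU   : ∀ {s} {a : s ∈ Γ} {P} → kind s ≡ inputControlled →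
                 ⊢ 1 ∶ P → ⊢ᵍ 1 ∶ recv a P
      ty-inX   : ∀ {s} {a : s ∈ Γ} {P} → kind s ≡ outputControlled →
                 ⊢ 1 ∶ P → ⊢ᵍ 0 ∶ recv a P
      ty-sum   : ∀ {η G H} → ⊢ᵍ η ∶ G → ⊢ᵍ η ∶ H → ⊢ᵍ η ∶ G ⊕ H
      ty-tau   : ∀ {η P} → ⊢ η ∶ P → ⊢ᵍ η ∶ tau P
      ty-match : ∀ {s t} {a : s ∈ Γ} {b : t ∈ Γ} {G} → ⊢ᵍ 0 ∶ G → ⊢ᵍ 0 ∶ [ a ≐ b ] G

{-# OPTIONS --safe #-}
-- Every interaction fires a capability that ⊢ counts — output on an
-- output-controlled name or input on an input-controlled one — and each such
-- capability costs one unit of η. The units of parallel components add up, so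
-- two simultaneous interactions in P₁ ∥ P₂ need η ≥ 2. Since ⊢ is not itself
-- closed under ≡ (with ⊢₁ G, the sum G ⊕ 𝟎 is not typable), the counting is
-- done in a relaxed judgement ⊢≤ where η is only an upper bound.
module Submission where

open import Defs
open import Data.Nat using (ℕ; _≤_; _+_)
open import Data.Nat.Properties
  using (≤-refl; ≤-trans; ≤-reflexive; +-assoc; +-comm; +-mono-≤; +-monoˡ-≤; +-monoʳ-≤;
         m+n≤o⇒m≤o; 1+n≰n; m+n≤o⇒n≤o)
open import Data.List using ([]; _∷_; _++_)
open import Data.List.Membership.Propositional using (_∈_)
open import Data.Product using (Σ; _×_; _,_)
open import Data.Empty using (⊥; ⊥-elim)
open import Relation.Nullary using (¬_)
open import Relation.Binary.PropositionalEquality using (_≡_; refl; sym; subst)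

kinds-disjoint : ∀ {k : Kind} → k ≡ outputControlled → k ≡ inputControlled → ⊥
kinds-disjoint refl ()

module _ (S : Sorting) where
  open Sorting S
  open Calculus S

  infix 4 ⊢≤_∶_ ⊢ᵍ≤_∶_
  mutual
    data ⊢≤_∶_ {Γ : Ctx} (η : ℕ) : Proc Γ → Set where
      repX : ∀ {s} {a : s ∈ Γ} {P} → kind s ≡ outputControlled →
             ⊢≤ 1 ∶ P → ⊢≤ η ∶ repl a P
      outX : ∀ {s} {a : s ∈ Γ} {c} → kind s ≡ outputControlled → 1 ≤ η →
             ⊢≤ η ∶ send a c
      outU : ∀ {s} {a : s ∈ Γ} {c} → kind s ≡ inputControlled → ⊢≤ η ∶ send a c
      res : ∀ {t} {P : Proc (t ∷ Γ)} → ⊢≤ η ∶ P → ⊢≤ η ∶ ν t P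
      par : ∀ {η₁ η₂ P Q} → ⊢≤ η₁ ∶ P → ⊢≤ η₂ ∶ Q → η₁ + η₂ ≤ η → ⊢≤ η ∶ P ∥ Q
      grd : ∀ {G} → ⊢ᵍ≤ η ∶ G → ⊢≤ η ∶ grd G

    data ⊢ᵍ≤_∶_ {Γ : Ctx} (η : ℕ) : Guard Γ → Set where
      nil : ⊢ᵍ≤ η ∶ 𝟎
      inU : ∀ {s} {a : s ∈ Γ} {P} → kind s ≡ inputControlled →
             ⊢≤ 1 ∶ P → 1 ≤ η → ⊢ᵍ≤ η ∶ recv a P
      inX : ∀ {s} {a : s ∈ Γ} {P} → kind s ≡ outputControlled →
             ⊢≤ 1 ∶ P → ⊢ᵍ≤ η ∶ recv a P
      sum : ∀ {G H} → ⊢ᵍ≤ η ∶ G → ⊢ᵍ≤ η ∶ H → ⊢ᵍ≤ η ∶ G ⊕ H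
      tau : ∀ {P} → ⊢≤ η ∶ P → ⊢ᵍ≤ η ∶ tau P
      match : ∀ {s t} {a : s ∈ Γ} {b : t ∈ Γ} {G} → ⊢ᵍ≤ 0 ∶ G → ⊢ᵍ≤ η ∶ [ a ≐ b ] G

  mutual
    ⊢⇒⊢≤ : ∀ {Γ η} {P : Proc Γ} → ⊢ η ∶ P → ⊢≤ η ∶ P
    ⊢⇒⊢≤ (ty-repX k d) = repX k (⊢⇒⊢≤ d)
    ⊢⇒⊢≤ (ty-outX k) = outX k ≤-refl
    ⊢⇒⊢≤ (ty-outU k) = outU k
    ⊢⇒⊢≤ (ty-res d) = res (⊢⇒⊢≤ d)
    ⊢⇒⊢≤ (ty-par d e _) = par (⊢⇒⊢≤ d) (⊢⇒⊢≤ e) ≤-refl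
    ⊢⇒⊢≤ (ty-grd g) = grd (⊢ᵍ⇒⊢ᵍ≤ g)

    ⊢ᵍ⇒⊢ᵍ≤ : ∀ {Γ η} {G : Guard Γ} → ⊢ᵍ η ∶ G → ⊢ᵍ≤ η ∶ G
    ⊢ᵍ⇒⊢ᵍ≤ ty-nil = nil
    ⊢ᵍ⇒⊢ᵍ≤ (ty-inU k d) = inU k (⊢⇒⊢≤ d) ≤-refl
    ⊢ᵍ⇒⊢ᵍ≤ (ty-inX k d) = inX k (⊢⇒⊢≤ d)
    ⊢ᵍ⇒⊢ᵍ≤ (ty-sum g h) = sum (⊢ᵍ⇒⊢ᵍ≤ g) (⊢ᵍ⇒⊢ᵍ≤ h)
    ⊢ᵍ⇒⊢ᵍ≤ (ty-tau d) = tau (⊢⇒⊢≤ d)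
    ⊢ᵍ⇒⊢ᵍ≤ (ty-match g) = match (⊢ᵍ⇒⊢ᵍ≤ g)

  mutual
    ⊢≤-mono : ∀ {Γ η η'} {P : Proc Γ} → η ≤ η' → ⊢≤ η ∶ P → ⊢≤ η' ∶ P
    ⊢≤-mono η≤η' (repX k d) = repX k d
    ⊢≤-mono η≤η' (outX k 1≤η) = outX k (≤-trans 1≤η η≤η')
    ⊢≤-mono η≤η' (outU k) = outU k
    ⊢≤-mono η≤η' (res d) = res (⊢≤-mono η≤η' d)
    ⊢≤-mono η≤η' (par d e h) = par d e (≤-trans h η≤η')
    ⊢≤-mono η≤η' (grd g) = grd (⊢ᵍ≤-mono η≤η' g)

    ⊢ᵍ≤-mono : ∀ {Γ η η'} {G : Guard Γ} → η ≤ η' → ⊢ᵍ≤ η ∶ G → ⊢ᵍ≤ η' ∶ G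
    ⊢ᵍ≤-mono η≤η' nil = nil
    ⊢ᵍ≤-mono η≤η' (inU k d 1≤η) = inU k d (≤-trans 1≤η η≤η')
    ⊢ᵍ≤-mono η≤η' (inX k d) = inX k d
    ⊢ᵍ≤-mono η≤η' (sum g h) = sum (⊢ᵍ≤-mono η≤η' g) (⊢ᵍ≤-mono η≤η' h)
    ⊢ᵍ≤-mono η≤η' (tau d) = tau (⊢≤-mono η≤η' d)
    ⊢ᵍ≤-mono η≤η' (match g) = match g

  mutual
    ⊢≤-rename : ∀ {Γ Δ η} {P : Proc Γ} (ρ : Ren Γ Δ) → ⊢≤ η ∶ P → ⊢≤ η ∶ rename ρ P
    ⊢≤-rename ρ (repX k d) = repX k (⊢≤-rename _ d)
    ⊢≤-rename ρ (outX k h) = outX k h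
    ⊢≤-rename ρ (outU k) = outU k
    ⊢≤-rename ρ (res d) = res (⊢≤-rename _ d)
    ⊢≤-rename ρ (par d e h) = par (⊢≤-rename ρ d) (⊢≤-rename ρ e) h
    ⊢≤-rename ρ (grd g) = grd (⊢ᵍ≤-rename ρ g)

    ⊢ᵍ≤-rename : ∀ {Γ Δ η} {G : Guard Γ} (ρ : Ren Γ Δ) → ⊢ᵍ≤ η ∶ G → ⊢ᵍ≤ η ∶ renameG ρ G
    ⊢ᵍ≤-rename ρ nil = nil
    ⊢ᵍ≤-rename ρ (inU k d h) = inU k (⊢≤-rename _ d) h
    ⊢ᵍ≤-rename ρ (inX k d) = inX k (⊢≤-rename _ d)
    ⊢ᵍ≤-rename ρ (sum g h) = sum (⊢ᵍ≤-rename ρ g) (⊢ᵍ≤-rename ρ h)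
    ⊢ᵍ≤-rename ρ (tau d) = tau (⊢≤-rename ρ d)
    ⊢ᵍ≤-rename ρ (match g) = match (⊢ᵍ≤-rename ρ g)

  mutual
    ⊢≤-rename⁻¹ : ∀ {Γ Δ η} (P : Proc Γ) (ρ : Ren Γ Δ) → ⊢≤ η ∶ rename ρ P → ⊢≤ η ∶ P
    ⊢≤-rename⁻¹ (send a c) ρ (outX k h) = outX k h
    ⊢≤-rename⁻¹ (send a c) ρ (outU k) = outU k
    ⊢≤-rename⁻¹ (repl a P) ρ (repX k d) = repX k (⊢≤-rename⁻¹ P _ d)
    ⊢≤-rename⁻¹ (P ∥ Q) ρ (par d e h) = par (⊢≤-rename⁻¹ P ρ d) (⊢≤-rename⁻¹ Q ρ e) h
    ⊢≤-rename⁻¹ (ν t P) ρ (res d) = res (⊢≤-rename⁻¹ P _ d)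
    ⊢≤-rename⁻¹ (grd G) ρ (grd g) = grd (⊢ᵍ≤-rename⁻¹ G ρ g)

    ⊢ᵍ≤-rename⁻¹ : ∀ {Γ Δ η} (G : Guard Γ) (ρ : Ren Γ Δ) → ⊢ᵍ≤ η ∶ renameG ρ G → ⊢ᵍ≤ η ∶ G
    ⊢ᵍ≤-rename⁻¹ 𝟎 ρ nil = nil
    ⊢ᵍ≤-rename⁻¹ (recv a P) ρ (inU k d h) = inU k (⊢≤-rename⁻¹ P _ d) h
    ⊢ᵍ≤-rename⁻¹ (recv a P) ρ (inX k d) = inX k (⊢≤-rename⁻¹ P _ d)
    ⊢ᵍ≤-rename⁻¹ (tau P) ρ (tau d) = tau (⊢≤-rename⁻¹ P ρ d)
    ⊢ᵍ≤-rename⁻¹ ([ a ≐ b ] G) ρ (match g) = match (⊢ᵍ≤-rename⁻¹ G ρ g)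
    ⊢ᵍ≤-rename⁻¹ (G ⊕ H) ρ (sum g h) = sum (⊢ᵍ≤-rename⁻¹ G ρ g) (⊢ᵍ≤-rename⁻¹ H ρ h)

  +-assoc-≤ : ∀ a b c {ab η} → a + b ≤ ab → ab + c ≤ η → a + (b + c) ≤ η
  +-assoc-≤ a b c h₁ h₂ = ≤-trans (≤-reflexive (sym (+-assoc a b c))) (≤-trans (+-monoˡ-≤ c h₁) h₂)

  +-assoc-≤˘ : ∀ a b c {bc η} → b + c ≤ bc → a + bc ≤ η → (a + b) + c ≤ η
  +-assoc-≤˘ a b c h₁ h₂ = ≤-trans (≤-reflexive (+-assoc a b c)) (≤-trans (+-monoʳ-≤ a h₁) h₂)

  +-comm-≤ : ∀ a b {η} → a + b ≤ η → b + a ≤ η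
  +-comm-≤ a b {η} = subst (_≤ η) (+-comm a b)

  mutual
    ⊢≤-resp-≃ : ∀ {Γ η} {P Q : Proc Γ} → P ≃ Q → ⊢≤ η ∶ P → ⊢≤ η ∶ Q
    ⊢≤-resp-≃ ≃-refl d = d
    ⊢≤-resp-≃ (≃-sym e) d = ⊢≤-resp-≃˘ e d
    ⊢≤-resp-≃ (≃-trans e f) d = ⊢≤-resp-≃ f (⊢≤-resp-≃ e d)
    ⊢≤-resp-≃ (≃-par e f) (par d d' h) = par (⊢≤-resp-≃ e d) (⊢≤-resp-≃ f d') h
    ⊢≤-resp-≃ (≃-res e) (res d) = res (⊢≤-resp-≃ e d)
    ⊢≤-resp-≃ (≃-repl e) (repX k d) = repX k (⊢≤-resp-≃ e d)
    ⊢≤-resp-≃ (≃-grd e) (grd g) = grd (⊢ᵍ≤-resp-≃ᵍ e g)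
    ⊢≤-resp-≃ par-nil (par {η₁} d _ h) = ⊢≤-mono (m+n≤o⇒m≤o η₁ h) d
    ⊢≤-resp-≃ par-comm (par {η₁} {η₂} d d' h) = par d' d (+-comm-≤ η₁ η₂ h)
    ⊢≤-resp-≃ par-assoc (par {η₂ = η₃} (par {η₁} {η₂} d₁ d₂ h₁) d₃ h₂) =
      par d₁ (par d₂ d₃ ≤-refl) (+-assoc-≤ η₁ η₂ η₃ h₁ h₂)
    ⊢≤-resp-≃ res-nil (res (grd _)) = grd nil
    ⊢≤-resp-≃ res-swap (res (res d)) = res (res (⊢≤-rename _ d))
    ⊢≤-resp-≃ res-par (par (res d) d' h) = res (par d (⊢≤-rename _ d') h)

    ⊢≤-resp-≃˘ : ∀ {Γ η} {P Q : Proc Γ} → P ≃ Q → ⊢≤ η ∶ Q → ⊢≤ η ∶ P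
    ⊢≤-resp-≃˘ ≃-refl d = d
    ⊢≤-resp-≃˘ (≃-sym e) d = ⊢≤-resp-≃ e d
    ⊢≤-resp-≃˘ (≃-trans e f) d = ⊢≤-resp-≃˘ e (⊢≤-resp-≃˘ f d)
    ⊢≤-resp-≃˘ (≃-par e f) (par d d' h) = par (⊢≤-resp-≃˘ e d) (⊢≤-resp-≃˘ f d') h
    ⊢≤-resp-≃˘ (≃-res e) (res d) = res (⊢≤-resp-≃˘ e d)
    ⊢≤-resp-≃˘ (≃-repl e) (repX k d) = repX k (⊢≤-resp-≃˘ e d)
    ⊢≤-resp-≃˘ (≃-grd e) (grd g) = grd (⊢ᵍ≤-resp-≃ᵍ˘ e g)
    ⊢≤-resp-≃˘ par-nil d = par d (grd nil) (≤-reflexive (+-comm _ 0))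
    ⊢≤-resp-≃˘ par-comm (par {η₁} {η₂} d d' h) = par d' d (+-comm-≤ η₁ η₂ h)
    ⊢≤-resp-≃˘ par-assoc (par {η₁} d₁ (par {η₂} {η₃} d₂ d₃ h₁) h₂) =
      par (par d₁ d₂ ≤-refl) d₃ (+-assoc-≤˘ η₁ η₂ η₃ h₁ h₂)
    ⊢≤-resp-≃˘ res-nil (grd _) = res (grd nil)
    ⊢≤-resp-≃˘ (res-swap {P = P}) (res (res d)) = res (res (⊢≤-rename⁻¹ P _ d))
    ⊢≤-resp-≃˘ (res-par {Q = Q}) (res (par d d' h)) = par (res d) (⊢≤-rename⁻¹ Q _ d') h

    ⊢ᵍ≤-resp-≃ᵍ : ∀ {Γ η} {G H : Guard Γ} → G ≃ᵍ H → ⊢ᵍ≤ η ∶ G → ⊢ᵍ≤ η ∶ H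
    ⊢ᵍ≤-resp-≃ᵍ ≃ᵍ-refl g = g
    ⊢ᵍ≤-resp-≃ᵍ (≃ᵍ-sym e) g = ⊢ᵍ≤-resp-≃ᵍ˘ e g
    ⊢ᵍ≤-resp-≃ᵍ (≃ᵍ-trans e f) g = ⊢ᵍ≤-resp-≃ᵍ f (⊢ᵍ≤-resp-≃ᵍ e g)
    ⊢ᵍ≤-resp-≃ᵍ (≃ᵍ-recv e) (inU k d h) = inU k (⊢≤-resp-≃ e d) h
    ⊢ᵍ≤-resp-≃ᵍ (≃ᵍ-recv e) (inX k d) = inX k (⊢≤-resp-≃ e d)
    ⊢ᵍ≤-resp-≃ᵍ (≃ᵍ-tau e) (tau d) = tau (⊢≤-resp-≃ e d)
    ⊢ᵍ≤-resp-≃ᵍ (≃ᵍ-match e) (match g) = match (⊢ᵍ≤-resp-≃ᵍ e g)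
    ⊢ᵍ≤-resp-≃ᵍ (≃ᵍ-sum e f) (sum g h) = sum (⊢ᵍ≤-resp-≃ᵍ e g) (⊢ᵍ≤-resp-≃ᵍ f h)
    ⊢ᵍ≤-resp-≃ᵍ sum-nil (sum g _) = g
    ⊢ᵍ≤-resp-≃ᵍ sum-comm (sum g h) = sum h g
    ⊢ᵍ≤-resp-≃ᵍ sum-assoc (sum (sum g₁ g₂) g₃) = sum g₁ (sum g₂ g₃)

    ⊢ᵍ≤-resp-≃ᵍ˘ : ∀ {Γ η} {G H : Guard Γ} → G ≃ᵍ H → ⊢ᵍ≤ η ∶ H → ⊢ᵍ≤ η ∶ G
    ⊢ᵍ≤-resp-≃ᵍ˘ ≃ᵍ-refl g = g
    ⊢ᵍ≤-resp-≃ᵍ˘ (≃ᵍ-sym e) g = ⊢ᵍ≤-resp-≃ᵍ e g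
    ⊢ᵍ≤-resp-≃ᵍ˘ (≃ᵍ-trans e f) g = ⊢ᵍ≤-resp-≃ᵍ˘ e (⊢ᵍ≤-resp-≃ᵍ˘ f g)
    ⊢ᵍ≤-resp-≃ᵍ˘ (≃ᵍ-recv e) (inU k d h) = inU k (⊢≤-resp-≃˘ e d) h
    ⊢ᵍ≤-resp-≃ᵍ˘ (≃ᵍ-recv e) (inX k d) = inX k (⊢≤-resp-≃˘ e d)
    ⊢ᵍ≤-resp-≃ᵍ˘ (≃ᵍ-tau e) (tau d) = tau (⊢≤-resp-≃˘ e d)
    ⊢ᵍ≤-resp-≃ᵍ˘ (≃ᵍ-match e) (match g) = match (⊢ᵍ≤-resp-≃ᵍ˘ e g)
    ⊢ᵍ≤-resp-≃ᵍ˘ (≃ᵍ-sum e f) (sum g h) = sum (⊢ᵍ≤-resp-≃ᵍ˘ e g) (⊢ᵍ≤-resp-≃ᵍ˘ f h)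
    ⊢ᵍ≤-resp-≃ᵍ˘ sum-nil g = sum g nil
    ⊢ᵍ≤-resp-≃ᵍ˘ sum-comm (sum g h) = sum h g
    ⊢ᵍ≤-resp-≃ᵍ˘ sum-assoc (sum g₁ (sum g₂ g₃)) = sum (sum g₁ g₂) g₃

  ⊢≤-νs⁻¹ : ∀ {Γ η} (Θ : Ctx) {R : Proc (Θ ++ Γ)} → ⊢≤ η ∶ νs Θ R → ⊢≤ η ∶ R
  ⊢≤-νs⁻¹ [] d = d
  ⊢≤-νs⁻¹ (t ∷ Θ) d with ⊢≤-νs⁻¹ Θ d
  ... | res d' = d'

  -- The capabilities that ⊢ charges to η.
  Controlled : ∀ {Γ Γ'} → Act Γ Γ' → Set
  Controlled τ = ⊥
  Controlled (inA {s} _ _) = kind s ≡ inputControlled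
  Controlled (outA {s} _ _ _) = kind s ≡ outputControlled

  controlledᵍ⇒1≤η : ∀ {Γ Γ' η} {G : Guard Γ} {μ : Act Γ Γ'} {P'} →
                    ⊢ᵍ≤ η ∶ G → G —[ μ ]→ᵍ P' → Controlled μ → 1 ≤ η
  controlledᵍ⇒1≤η (inU _ _ 1≤η) (g-in _) _ = 1≤η
  controlledᵍ⇒1≤η (inX k _) (g-in _) k' = ⊥-elim (kinds-disjoint k k')
  controlledᵍ⇒1≤η (match g) (g-match d) k with controlledᵍ⇒1≤η g d k
  ... | ()
  controlledᵍ⇒1≤η (sum g _) (g-sumL d) k = controlledᵍ⇒1≤η g d k
  controlledᵍ⇒1≤η (sum _ h) (g-sumR d) k = controlledᵍ⇒1≤η h d k

  controlled⇒1≤η : ∀ {Γ Γ' η} {P : Proc Γ} {μ : Act Γ Γ'} {P'} →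
                   ⊢≤ η ∶ P → P —[ μ ]→ P' → Controlled μ → 1 ≤ η
  controlled⇒1≤η (outX _ 1≤η) t-out _ = 1≤η
  controlled⇒1≤η (outU k) t-out k' = ⊥-elim (kinds-disjoint k' k)
  controlled⇒1≤η (repX k _) (t-rep _) k' = ⊥-elim (kinds-disjoint k k')
  controlled⇒1≤η (grd g) (t-grd d) k = controlledᵍ⇒1≤η g d k
  controlled⇒1≤η (par {η₁} d _ h) (t-parL e) k = ≤-trans (controlled⇒1≤η d e k) (m+n≤o⇒m≤o η₁ h)
  controlled⇒1≤η (par {η₁} _ d h) (t-parR e) k = ≤-trans (controlled⇒1≤η d e k) (m+n≤o⇒n≤o η₁ h)
  controlled⇒1≤η (res d) (t-resIn e) k = controlled⇒1≤η d e k
  controlled⇒1≤η (res d) (t-resOut e) k = controlled⇒1≤η d e k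
  controlled⇒1≤η (res d) (t-open e _) k = controlled⇒1≤η d e k

  -- The channel of a communication is controlled on exactly one of its two sides.
  interaction⇒1≤η : ∀ {Γ Γ' η} {P : Proc Γ} {μ : Act Γ Γ'} {P'} →
                    ⊢≤ η ∶ P → (d : P —[ μ ]→ P') → Interaction d → 1 ≤ η
  interaction⇒1≤η (par {η₁} d _ h) (t-parL e) i = ≤-trans (interaction⇒1≤η d e i) (m+n≤o⇒m≤o η₁ h)
  interaction⇒1≤η (par {η₁} _ d h) (t-parR e) i = ≤-trans (interaction⇒1≤η d e i) (m+n≤o⇒n≤o η₁ h)
  interaction⇒1≤η (par {η₁} d d' h) (t-commL {s = s} {Θ = Θ} o i) _ with kind s in k
  ... | outputControlled = ≤-trans (controlled⇒1≤η d o k) (m+n≤o⇒m≤o η₁ h)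
  ... | inputControlled = ≤-trans (controlled⇒1≤η (⊢≤-rename (wk Θ) d') i k) (m+n≤o⇒n≤o η₁ h)
  interaction⇒1≤η (par {η₁} d d' h) (t-commR {s = s} {Θ = Θ} i o) _ with kind s in k
  ... | outputControlled = ≤-trans (controlled⇒1≤η d' o k) (m+n≤o⇒n≤o η₁ h)
  ... | inputControlled = ≤-trans (controlled⇒1≤η (⊢≤-rename (wk Θ) d) i k) (m+n≤o⇒m≤o η₁ h)
  interaction⇒1≤η (res d) (t-resτ e) i = interaction⇒1≤η d e i
  interaction⇒1≤η (res d) (t-resIn e) i = interaction⇒1≤η d e i
  interaction⇒1≤η (res d) (t-resOut e) i = interaction⇒1≤η d e i
  interaction⇒1≤η (res d) (t-open e _) i = interaction⇒1≤η d e i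

  parallel-interactions⇒2≤η : ∀ {Γ η} {P₁ P₂ P₁' P₂' : Proc Γ} → ⊢≤ η ∶ P₁ ∥ P₂ →
                              (d₁ : P₁ —[ τ ]→ P₁') → Interaction d₁ →
                              (d₂ : P₂ —[ τ ]→ P₂') → Interaction d₂ → 2 ≤ η
  parallel-interactions⇒2≤η (par t₁ t₂ h) d₁ i₁ d₂ i₂ =
    ≤-trans (+-mono-≤ (interaction⇒1≤η t₁ d₁ i₁) (interaction⇒1≤η t₂ d₂ i₂)) h

mainTheorem4 : (S : Sorting) → let open Calculus S in
    ∀ {Γ : Ctx} {η : ℕ} (P : Proc Γ) → η ≤ 1 → ⊢ η ∶ P →
      ¬ (Σ Ctx λ Θ → Σ (Proc (Θ ++ Γ)) λ P₁ → Σ (Proc (Θ ++ Γ)) λ P₂ →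
           (P ≃ νs Θ (P₁ ∥ P₂))
           × (Σ (Proc (Θ ++ Γ)) λ P₁' → Σ (P₁ —[ τ ]→ P₁') λ d₁ → Interaction d₁)
           × (Σ (Proc (Θ ++ Γ)) λ P₂' → Σ (P₂ —[ τ ]→ P₂') λ d₂ → Interaction d₂))
mainTheorem4 S {η = η} P η≤1 ⊢P (Θ , P₁ , P₂ , P≃νs , (_ , d₁ , i₁) , (_ , d₂ , i₂)) =
  1+n≰n (≤-trans (parallel-interactions⇒2≤η S ⊢P₁∥P₂ d₁ i₁ d₂ i₂) η≤1)
  where
  open Calculus S using (_∥_)
  ⊢P₁∥P₂ : ⊢≤_∶_ S η (P₁ ∥ P₂)
  ⊢P₁∥P₂ = ⊢≤-νs⁻¹ S Θ (⊢≤-resp-≃ S P≃νs (⊢⇒⊢≤ S ⊢P))
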